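{- Suppose $g_k=\tilde g_k$ for all $k$. Then the Laurent series satisfy the duality $Q_\circ(z)=Q_\bullet\!\left(\frac{R}{z}\right)$, and $R$ can alternatively be recovered as $$R=1+\sum_k g_k\left[Q_\bullet(z)^{k-1}\,z\right]_0 .$$
   Context: Consider pointed planar Eulerian maps (faces bicolored black/white, edges oriented clockwise around black faces) with blocked edges satisfying the global connectivity constraint that every vertex can be reached from the origin vertex by an oriented path using only non-blocked edges. Each white (resp. black) $k$-valent face receives weight $g_k$ (resp. $\tilde g_k$), $k\le p$, and each blocked edge receives weight $y$. Let $R$ be the generating function of such maps with a distinguished non-blocked edge pointing from a vertex at distance $m$ from the origin to one at distance $m+1$ (equivalently, unrestricted labeled mobiles rooted at a corner with fixed label). Via the mobile coding one defines Laurent series $Q_\circ(z)$, $Q_\bullet(z)$ in a formal variable $z$, and $R$, $Q_\circ$, $Q_\bullet$ are determined by the closed system $$Q_\circ(z)=\frac{R}{z}+\sum_k\tilde g_k\left[Q_\bullet^{k-1}(z)\right]_+ + y\sum_k\tilde g_k\,Q_\bullet^{k-1}(z),$$ $$Q_\bullet(z)=z+\sum_k g_k\left[Q_\circ^{k-1}(z)\right]_- + y\sum_k g_k\,Q_\circ^{k-1}(z),$$ $$R=1+\sum_k g_k\left[\frac{Q_\circ^{k-1}(z)}{z}\right]_0 R,$$ where $[\cdot]_+$, $[\cdot]_-$, $[\cdot]_0$ denote extraction of the non-negative power part, the non-positive power part, and the constant term of a Laurent series in $z$. -}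

module Defs where

open import Data.Nat as ℕ using (ℕ; zero; suc; _⊔_; _<_)
open import Data.Integer as ℤ using (ℤ; +_; 0ℤ; 1ℤ; ∣_∣)
open import Data.Fin using (Fin; zero; suc; toℕ)
open import Data.Vec using (Vec; []; _∷_; replicate)
open import Data.Vec.Properties using (≡-dec)
open import Data.List using (List; []; _∷_; [_]; map; concatMap; foldr; upTo; allFin)
open import Data.Product using (_×_; _,_)
open import Data.Bool using (if_then_else_)
open import Relation.Nullary.Decidable using (does)
open import Relation.Binary.PropositionalEquality using (_≡_)

-- Monomials in the weight variables: exponent vectors.
Mon : ℕ → Set
Mon n = Vec ℕ n

zeroMon : ∀ {n} → Mon n
zeroMon = replicate _ 0

unitMon : ∀ {n} → Fin n → Mon n
unitMon {suc n} zero = 1 ∷ zeroMon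
unitMon {suc n} (suc i) = 0 ∷ unitMon i

splitsℕ : ℕ → List (ℕ × ℕ)
splitsℕ k = map (λ i → i , k ℕ.∸ i) (upTo (suc k))

splits : ∀ {n} → Mon n → List (Mon n × Mon n)
splits [] = [ ([] , []) ]
splits (k ∷ m) =
  concatMap (λ ab → map (λ uv → (Data.Product.proj₁ ab ∷ Data.Product.proj₁ uv)
                              , (Data.Product.proj₂ ab ∷ Data.Product.proj₂ uv)) (splits m))
            (splitsℕ k)

sumℤ : List ℤ → ℤ
sumℤ = foldr ℤ._+_ 0ℤ

maxℕ : List ℕ → ℕ
maxℕ = foldr _⊔_ 0

PS : ℕ → Set
PS n = Mon n → ℤ

_≈ₚ_ : ∀ {n} → PS n → PS n → Set
A ≈ₚ B = ∀ m → A m ≡ B m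

_+ₚ_ : ∀ {n} → PS n → PS n → PS n
(A +ₚ B) m = A m ℤ.+ B m

_*ₚ_ : ∀ {n} → PS n → PS n → PS n
(A *ₚ B) m = sumℤ (map (λ uv → A (Data.Product.proj₁ uv) ℤ.* B (Data.Product.proj₂ uv)) (splits m))

zeroₚ : ∀ {n} → PS n
zeroₚ _ = 0ℤ

oneₚ : ∀ {n} → PS n
oneₚ m = if does (≡-dec ℕ._≟_ m zeroMon) then 1ℤ else 0ℤ

varₚ : ∀ {n} → Fin n → PS n
varₚ i m = if does (≡-dec ℕ._≟_ m (unitMon i)) then 1ℤ else 0ℤ

powₚ : ∀ {n} → PS n → ℕ → PS n
powₚ A zero = oneₚ
powₚ A (suc k) = A *ₚ powₚ A k

-- Laurent series in z whose coefficients are formal power series, such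
-- that for each monomial only finitely many powers of z occur.
-- 'bnd m' is a bound on |j| for the nonzero coefficients of z^j x^m
-- (the bound is part of the data; 'WF' asserts it is correct).

record LS (n : ℕ) : Set where
  field
    coef : Mon n → ℤ → ℤ
    bnd  : Mon n → ℕ
open LS public

WF : ∀ {n} → LS n → Set
WF A = ∀ m j → bnd A m < ∣ j ∣ → coef A m j ≡ 0ℤ

_≈_ : ∀ {n} → LS n → LS n → Set
A ≈ B = ∀ m j → coef A m j ≡ coef B m j

range : ℕ → List ℤ
range b = map (λ i → (+ i) ℤ.- (+ b)) (upTo (suc (b ℕ.+ b)))

_⊕_ : ∀ {n} → LS n → LS n → LS n
coef (A ⊕ B) m j = coef A m j ℤ.+ coef B m j
bnd  (A ⊕ B) m = bnd A m ⊔ bnd B m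

zeroL : ∀ {n} → LS n
coef zeroL _ _ = 0ℤ
bnd  zeroL _ = 0

_⊗_ : ∀ {n} → LS n → LS n → LS n
coef (A ⊗ B) m j =
  sumℤ (map (λ uv → sumℤ (map (λ i → coef A (Data.Product.proj₁ uv) i
                                       ℤ.* coef B (Data.Product.proj₂ uv) (j ℤ.- i))
                              (range (bnd A (Data.Product.proj₁ uv)))))
            (splits m))
bnd (A ⊗ B) m =
  maxℕ (map (λ uv → bnd A (Data.Product.proj₁ uv) ℕ.+ bnd B (Data.Product.proj₂ uv)) (splits m))

embed : ∀ {n} → PS n → LS n
coef (embed P) m j = if does (j ℤ.≟ 0ℤ) then P m else 0ℤ
bnd  (embed P) _ = 0

oneL : ∀ {n} → LS n
oneL = embed oneₚ

zL : ∀ {n} → LS n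
coef zL m j = if does (j ℤ.≟ 1ℤ) then oneₚ m else 0ℤ
bnd  zL _ = 1

shift : ∀ {n} → ℤ → LS n → LS n
coef (shift e A) m j = coef A m (j ℤ.- e)
bnd  (shift e A) m = bnd A m ℕ.+ ∣ e ∣

powL : ∀ {n} → LS n → ℕ → LS n
powL A zero = oneL
powL A (suc k) = A ⊗ powL A k

posPart : ∀ {n} → LS n → LS n
coef (posPart A) m j = if does (0ℤ ℤ.≤? j) then coef A m j else 0ℤ
bnd  (posPart A) = bnd A

negPart : ∀ {n} → LS n → LS n
coef (negPart A) m j = if does (j ℤ.≤? 0ℤ) then coef A m j else 0ℤ
bnd  (negPart A) = bnd A

const0 : ∀ {n} → LS n → PS n
const0 A m = coef A m 0ℤ

zpowₚ : ∀ {n} → PS n → PS n → ℤ → PS n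
zpowₚ R Rinv (+ k) = powₚ R k
zpowₚ R Rinv (ℤ.-[1+ k ]) = powₚ Rinv (suc k)

-- Q(R/z) = Σ_i [z^i]Q · R^i · z^{-i}   (Rinv is the inverse of R)
substRz : ∀ {n} → LS n → PS n → PS n → LS n
coef (substRz Q R Rinv) M j =
  sumℤ (map (λ uv → coef Q (Data.Product.proj₁ uv) (ℤ.- j)
                     ℤ.* zpowₚ R Rinv (ℤ.- j) (Data.Product.proj₂ uv))
            (splits M))
bnd (substRz Q R Rinv) M = maxℕ (map (λ uv → bnd Q (Data.Product.proj₁ uv)) (splits M))

-- Weights: n = suc p variables; variable 'zero' is y, variable 'suc i'
-- is g_k = g̃_k with k = toℕ i + 1  (so 1 ≤ k ≤ p).

yW : ∀ {p} → PS (suc p)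
yW = varₚ zero

gW : ∀ {p} → Fin p → PS (suc p)
gW i = varₚ (suc i)

ΣL : ∀ {p} → (Fin p → LS (suc p)) → LS (suc p)
ΣL {p} f = foldr (λ i acc → f i ⊕ acc) zeroL (allFin p)

Σₚ : ∀ {p} → (Fin p → PS (suc p)) → PS (suc p)
Σₚ {p} f = foldr (λ i acc → f i +ₚ acc) zeroₚ (allFin p)

-- The system (with g_k = g̃_k); k-1 = toℕ i.
EqQcirc : ∀ {p} → PS (suc p) → LS (suc p) → LS (suc p) → Set
EqQcirc R Qc Qb =
  Qc ≈ (shift (ℤ.- 1ℤ) (embed R)
        ⊕ (ΣL (λ i → embed (gW i) ⊗ posPart (powL Qb (toℕ i)))
        ⊕ (embed yW ⊗ ΣL (λ i → embed (gW i) ⊗ powL Qb (toℕ i)))))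

EqQbullet : ∀ {p} → PS (suc p) → LS (suc p) → LS (suc p) → Set
EqQbullet R Qc Qb =
  Qb ≈ (zL
        ⊕ (ΣL (λ i → embed (gW i) ⊗ negPart (powL Qc (toℕ i)))
        ⊕ (embed yW ⊗ ΣL (λ i → embed (gW i) ⊗ powL Qc (toℕ i)))))

EqR : ∀ {p} → PS (suc p) → LS (suc p) → LS (suc p) → Set
EqR R Qc Qb =
  R ≈ₚ (oneₚ +ₚ (Σₚ (λ i → gW i *ₚ const0 (shift (ℤ.- 1ℤ) (powL Qc (toℕ i)))) *ₚ R))

-- Since R is invertible, the substitution σ : z ↦ R/z is a ring automorphism of the Laurent
-- series which fixes the weights, exchanges [·]₊ with [·]₋ and z with R/z. Applying σ to the
-- system therefore exchanges the equations for Q∘ and Q•, so (σ Q•, σ Q∘) is a solution too.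
-- Apart from R/z and z, every term carries a weight g_k or y, so the coefficients of a solution
-- at weight degree d are determined by those of lower degree: the solution is unique, whence
-- Q∘ = σ Q• and Q• = σ Q∘. Finally [z Q•^(k-1)]₀ = [z⁻¹] σ(Q∘^(k-1)) = R [Q∘^(k-1)/z]₀, which
-- turns the equation for R into the claimed formula.

module Submission where

open import Defs
open import Data.Nat using (ℕ; suc)
open import Data.Integer using (1ℤ)
open import Data.Fin using (toℕ)
open import Data.Product using (_×_)

open import Data.Nat as ℕ using (zero; _∸_; s≤s; z≤n)
import Data.Nat.Properties as ℕᵖ
open import Data.Integer as ℤ using (ℤ; +0; +[1+_]; -[1+_]; 0ℤ; _+_; _*_; _-_; -_; ∣_∣)
import Data.Integer.Properties as ℤᵖ
open import Data.Integer.Solver using (module +-*-Solver)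
open import Data.Fin using (Fin)
open import Data.Product using (_,_; proj₁; proj₂; uncurry)
open import Data.Sum using (inj₁; inj₂)
open import Data.List using (List; []; _∷_; [_]; map; concatMap; foldr; upTo; applyUpTo; _++_; allFin)
import Data.List.Properties as Listᵖ
open import Data.List.Membership.Propositional using (_∈_; find)
import Data.List.Membership.Propositional.Properties as ∈ᵖ
open import Data.List.Relation.Unary.Any using (here; there)
open import Data.Vec using ([]; _∷_)
open import Data.Vec.Properties using (≡-dec)
open import Data.Bool using (true; false)
open import Function using (id; _∘_; flip)
open import Relation.Nullary using (yes; no; does)
open import Relation.Binary.Bundles using (Setoid)
open import Relation.Binary.Structures using (IsEquivalence)
open import Relation.Binary.PropositionalEquality using (_≡_; refl; sym; trans; cong; cong₂; subst; module ≡-Reasoning)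
import Relation.Binary.Reasoning.Setoid as SetoidReasoning
import Algebra.Properties.CommutativeSemigroup as CommSemigroupProperties

+-interchange : (a b c d : ℤ) → (a + b) + (c + d) ≡ (a + c) + (b + d)
+-interchange = CommSemigroupProperties.interchange ℤᵖ.+-commutativeSemigroup

≡0⇒*≡0 : {a : ℤ} (b : ℤ) → a ≡ 0ℤ → a * b ≡ 0ℤ
≡0⇒*≡0 b refl = ℤᵖ.*-zeroˡ b

∑ : {A : Set} → List A → (A → ℤ) → ℤ
∑ xs f = sumℤ (map f xs)

module _ {A : Set} where

  ∑-cong : (xs : List A) {f g : A → ℤ} → (∀ x → f x ≡ g x) → ∑ xs f ≡ ∑ xs g
  ∑-cong [] e = refl
  ∑-cong (x ∷ xs) e = cong₂ _+_ (e x) (∑-cong xs e)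

  ∑-cong-∈ : (xs : List A) {f g : A → ℤ} → (∀ x → x ∈ xs → f x ≡ g x) → ∑ xs f ≡ ∑ xs g
  ∑-cong-∈ [] e = refl
  ∑-cong-∈ (x ∷ xs) e = cong₂ _+_ (e x (here refl)) (∑-cong-∈ xs (λ y y∈ → e y (there y∈)))

  ∑-0 : (xs : List A) → ∑ xs (λ _ → 0ℤ) ≡ 0ℤ
  ∑-0 [] = refl
  ∑-0 (x ∷ xs) = trans (ℤᵖ.+-identityˡ _) (∑-0 xs)

  ∑-0-∈ : (xs : List A) {f : A → ℤ} → (∀ x → x ∈ xs → f x ≡ 0ℤ) → ∑ xs f ≡ 0ℤ
  ∑-0-∈ xs e = trans (∑-cong-∈ xs e) (∑-0 xs)

  ∑-distrib-+ : (xs : List A) (f g : A → ℤ) → ∑ xs (λ x → f x + g x) ≡ ∑ xs f + ∑ xs g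
  ∑-distrib-+ [] f g = refl
  ∑-distrib-+ (x ∷ xs) f g =
    trans (cong ((f x + g x) +_) (∑-distrib-+ xs f g)) (+-interchange (f x) (g x) _ _)

  *-distribˡ-∑ : (xs : List A) (c : ℤ) (f : A → ℤ) → c * ∑ xs f ≡ ∑ xs (λ x → c * f x)
  *-distribˡ-∑ [] c f = ℤᵖ.*-zeroʳ c
  *-distribˡ-∑ (x ∷ xs) c f =
    trans (ℤᵖ.*-distribˡ-+ c (f x) _) (cong (c * f x +_) (*-distribˡ-∑ xs c f))

  *-distribʳ-∑ : (xs : List A) (c : ℤ) (f : A → ℤ) → ∑ xs f * c ≡ ∑ xs (λ x → f x * c)
  *-distribʳ-∑ xs c f = begin
    ∑ xs f * c            ≡⟨ ℤᵖ.*-comm (∑ xs f) c ⟩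
    c * ∑ xs f            ≡⟨ *-distribˡ-∑ xs c f ⟩
    ∑ xs (λ x → c * f x)  ≡⟨ ∑-cong xs (λ x → ℤᵖ.*-comm c (f x)) ⟩
    ∑ xs (λ x → f x * c)  ∎
    where open ≡-Reasoning

  ∑-++ : (xs ys : List A) (f : A → ℤ) → ∑ (xs ++ ys) f ≡ ∑ xs f + ∑ ys f
  ∑-++ [] ys f = sym (ℤᵖ.+-identityˡ _)
  ∑-++ (x ∷ xs) ys f = trans (cong (f x +_) (∑-++ xs ys f)) (sym (ℤᵖ.+-assoc (f x) _ _))

∑-map : {A B : Set} (xs : List A) (h : A → B) (f : B → ℤ) → ∑ (map h xs) f ≡ ∑ xs (f ∘ h)
∑-map xs h f = cong sumℤ (sym (Listᵖ.map-∘ xs))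

∑-concatMap : {A B : Set} (xs : List A) (g : A → List B) (f : B → ℤ) →
  ∑ (concatMap g xs) f ≡ ∑ xs (λ x → ∑ (g x) f)
∑-concatMap [] g f = refl
∑-concatMap (x ∷ xs) g f =
  trans (∑-++ (g x) (concatMap g xs) f) (cong (∑ (g x) f +_) (∑-concatMap xs g f))

∑-comm : {A B : Set} (xs : List A) (ys : List B) (f : A → B → ℤ) →
  ∑ xs (λ x → ∑ ys (f x)) ≡ ∑ ys (λ y → ∑ xs (λ x → f x y))
∑-comm [] ys f = sym (∑-0 ys)
∑-comm (x ∷ xs) ys f =
  trans (cong (∑ ys (f x) +_) (∑-comm xs ys f)) (sym (∑-distrib-+ ys (f x) _))

∑-upTo-suc : (n : ℕ) (F : ℕ → ℤ) → ∑ (upTo (suc n)) F ≡ F 0 + ∑ (upTo n) (F ∘ suc)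
∑-upTo-suc n F = cong (F 0 +_) (begin
  sumℤ (map F (applyUpTo suc n))   ≡⟨ cong sumℤ (Listᵖ.map-applyUpTo suc F n) ⟩
  sumℤ (applyUpTo (F ∘ suc) n)     ≡⟨ cong sumℤ (Listᵖ.map-upTo (F ∘ suc) n) ⟨
  ∑ (upTo n) (F ∘ suc)             ∎)
  where open ≡-Reasoning

∑-splitsℕ-suc : (k : ℕ) (f : ℕ → ℕ → ℤ) →
  ∑ (splitsℕ (suc k)) (uncurry f) ≡ f 0 (suc k) + ∑ (splitsℕ k) (uncurry (f ∘ suc))
∑-splitsℕ-suc k f = begin
  ∑ (splitsℕ (suc k)) (uncurry f)
    ≡⟨ ∑-map (upTo (suc (suc k))) _ (uncurry f) ⟩
  ∑ (upTo (suc (suc k))) (λ i → f i (suc k ∸ i))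
    ≡⟨ ∑-upTo-suc (suc k) (λ i → f i (suc k ∸ i)) ⟩
  f 0 (suc k) + ∑ (upTo (suc k)) (λ i → f (suc i) (k ∸ i))
    ≡⟨ cong (f 0 (suc k) +_) (∑-map (upTo (suc k)) _ (uncurry (f ∘ suc))) ⟨
  f 0 (suc k) + ∑ (splitsℕ k) (uncurry (f ∘ suc)) ∎
  where open ≡-Reasoning

∑-splitsℕ-sucʳ : (k : ℕ) (f : ℕ → ℕ → ℤ) →
  ∑ (splitsℕ (suc k)) (uncurry f) ≡ ∑ (splitsℕ k) (uncurry (λ a b → f a (suc b))) + f (suc k) 0
∑-splitsℕ-sucʳ zero f = begin
  f 0 1 + (f 1 0 + 0ℤ)  ≡⟨ cong (f 0 1 +_) (ℤᵖ.+-identityʳ (f 1 0)) ⟩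
  f 0 1 + f 1 0         ≡⟨ cong (_+ f 1 0) (ℤᵖ.+-identityʳ (f 0 1)) ⟨
  (f 0 1 + 0ℤ) + f 1 0  ∎
  where open ≡-Reasoning
∑-splitsℕ-sucʳ (suc k) f = begin
  ∑ (splitsℕ (suc (suc k))) (uncurry f)
    ≡⟨ ∑-splitsℕ-suc (suc k) f ⟩
  f 0 (suc (suc k)) + ∑ (splitsℕ (suc k)) (uncurry (f ∘ suc))
    ≡⟨ cong (f 0 (suc (suc k)) +_) (∑-splitsℕ-sucʳ k (f ∘ suc)) ⟩
  f 0 (suc (suc k)) + (∑ (splitsℕ k) (uncurry (λ a b → f (suc a) (suc b))) + f (suc (suc k)) 0)
    ≡⟨ ℤᵖ.+-assoc (f 0 (suc (suc k))) _ _ ⟨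
  (f 0 (suc (suc k)) + ∑ (splitsℕ k) (uncurry (λ a b → f (suc a) (suc b)))) + f (suc (suc k)) 0
    ≡⟨ cong (_+ f (suc (suc k)) 0) (∑-splitsℕ-suc k (λ a b → f a (suc b))) ⟨
  ∑ (splitsℕ (suc k)) (uncurry (λ a b → f a (suc b))) + f (suc (suc k)) 0 ∎
  where open ≡-Reasoning

∑-splitsℕ-swap : (k : ℕ) (f : ℕ → ℕ → ℤ) →
  ∑ (splitsℕ k) (uncurry f) ≡ ∑ (splitsℕ k) (uncurry (flip f))
∑-splitsℕ-swap zero f = refl
∑-splitsℕ-swap (suc k) f = begin
  ∑ (splitsℕ (suc k)) (uncurry f)                        ≡⟨ ∑-splitsℕ-suc k f ⟩
  f 0 (suc k) + ∑ (splitsℕ k) (uncurry (f ∘ suc))        ≡⟨ cong (f 0 (suc k) +_) (∑-splitsℕ-swap k (f ∘ suc)) ⟩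
  f 0 (suc k) + ∑ (splitsℕ k) (uncurry (flip (f ∘ suc))) ≡⟨ ℤᵖ.+-comm (f 0 (suc k)) _ ⟩
  ∑ (splitsℕ k) (uncurry (flip (f ∘ suc))) + f 0 (suc k) ≡⟨ ∑-splitsℕ-sucʳ k (flip f) ⟨
  ∑ (splitsℕ (suc k)) (uncurry (flip f))                 ∎
  where open ≡-Reasoning

∑-splitsℕ-assoc : (k : ℕ) (G : ℕ → ℕ → ℕ → ℤ) →
  ∑ (splitsℕ k) (uncurry λ x c → ∑ (splitsℕ x) (uncurry λ a b → G a b c))
  ≡ ∑ (splitsℕ k) (uncurry λ a y → ∑ (splitsℕ y) (uncurry (G a)))
∑-splitsℕ-assoc zero G = refl
∑-splitsℕ-assoc (suc k) G = begin
  ∑ (splitsℕ (suc k)) (uncurry λ x c → ∑ (splitsℕ x) (uncurry λ a b → G a b c))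
    ≡⟨ ∑-splitsℕ-suc k (λ x c → ∑ (splitsℕ x) (uncurry λ a b → G a b c)) ⟩
  (a₀ + 0ℤ) + ∑ (splitsℕ k) (uncurry λ x c → ∑ (splitsℕ (suc x)) (uncurry λ a b → G a b c))
    ≡⟨ cong ((a₀ + 0ℤ) +_) (∑-cong (splitsℕ k) (uncurry λ x c → ∑-splitsℕ-suc x (λ a b → G a b c))) ⟩
  (a₀ + 0ℤ) + ∑ (splitsℕ k) (uncurry λ x c → G 0 (suc x) c + ∑ (splitsℕ x) (uncurry λ a b → G (suc a) b c))
    ≡⟨ cong ((a₀ + 0ℤ) +_) (∑-distrib-+ (splitsℕ k) (uncurry λ x c → G 0 (suc x) c) _) ⟩
  (a₀ + 0ℤ) + (b₀ + ∑ (splitsℕ k) (uncurry λ x c → ∑ (splitsℕ x) (uncurry λ a b → G (suc a) b c)))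
    ≡⟨ cong (λ t → (a₀ + 0ℤ) + (b₀ + t)) (∑-splitsℕ-assoc k (G ∘ suc)) ⟩
  (a₀ + 0ℤ) + (b₀ + rest)
    ≡⟨ cong (λ t → t + (b₀ + rest)) (ℤᵖ.+-identityʳ a₀) ⟩
  a₀ + (b₀ + rest)
    ≡⟨ ℤᵖ.+-assoc a₀ b₀ rest ⟨
  (a₀ + b₀) + rest
    ≡⟨ cong (_+ rest) (∑-splitsℕ-suc k (G 0)) ⟨
  ∑ (splitsℕ (suc k)) (uncurry (G 0)) + rest
    ≡⟨ ∑-splitsℕ-suc k (λ a y → ∑ (splitsℕ y) (uncurry (G a))) ⟨
  ∑ (splitsℕ (suc k)) (uncurry λ a y → ∑ (splitsℕ y) (uncurry (G a))) ∎
  where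
  open ≡-Reasoning
  a₀ b₀ rest : ℤ
  a₀ = G 0 0 (suc k)
  b₀ = ∑ (splitsℕ k) (uncurry λ x c → G 0 (suc x) c)
  rest = ∑ (splitsℕ k) (uncurry λ a y → ∑ (splitsℕ y) (uncurry (G (suc a))))

δ₀ : ℕ → ℤ
δ₀ zero    = 1ℤ
δ₀ (suc _) = 0ℤ

∑-splitsℕ-δ₀ : (k : ℕ) (F : ℕ → ℤ) → ∑ (splitsℕ k) (uncurry λ a b → δ₀ a * F b) ≡ F k
∑-splitsℕ-δ₀ zero F = trans (ℤᵖ.+-identityʳ _) (ℤᵖ.*-identityˡ (F 0))
∑-splitsℕ-δ₀ (suc k) F = begin
  ∑ (splitsℕ (suc k)) (uncurry λ a b → δ₀ a * F b)  ≡⟨ ∑-splitsℕ-suc k (λ a b → δ₀ a * F b) ⟩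
  1ℤ * F (suc k) + ∑ (splitsℕ k) (λ _ → 0ℤ)          ≡⟨ cong₂ _+_ (ℤᵖ.*-identityˡ (F (suc k))) (∑-0 (splitsℕ k)) ⟩
  F (suc k) + 0ℤ                                     ≡⟨ ℤᵖ.+-identityʳ _ ⟩
  F (suc k)                                          ∎
  where open ≡-Reasoning

module _ {n : ℕ} where

  ∑-splits-∷ : (k : ℕ) (m : Mon n) (f : Mon (suc n) → Mon (suc n) → ℤ) →
    ∑ (splits (k ∷ m)) (uncurry f)
    ≡ ∑ (splitsℕ k) (uncurry λ a b → ∑ (splits m) (uncurry λ u v → f (a ∷ u) (b ∷ v)))
  ∑-splits-∷ k m f = trans (∑-concatMap (splitsℕ k) (λ ab → map (extend ab) (splits m)) (uncurry f))
    (∑-cong (splitsℕ k) (λ ab → ∑-map (splits m) (extend ab) (uncurry f)))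
    where
    extend : ℕ × ℕ → Mon n × Mon n → Mon (suc n) × Mon (suc n)
    extend (a , b) (u , v) = a ∷ u , b ∷ v

∑-splits-swap : {n : ℕ} (M : Mon n) (f : Mon n → Mon n → ℤ) →
  ∑ (splits M) (uncurry f) ≡ ∑ (splits M) (uncurry (flip f))
∑-splits-swap [] f = refl
∑-splits-swap (k ∷ m) f = begin
  ∑ (splits (k ∷ m)) (uncurry f)
    ≡⟨ ∑-splits-∷ k m f ⟩
  ∑ (splitsℕ k) (uncurry λ a b → ∑ (splits m) (uncurry λ u v → f (a ∷ u) (b ∷ v)))
    ≡⟨ ∑-splitsℕ-swap k (λ a b → ∑ (splits m) (uncurry λ u v → f (a ∷ u) (b ∷ v))) ⟩
  ∑ (splitsℕ k) (uncurry λ a b → ∑ (splits m) (uncurry λ u v → f (b ∷ u) (a ∷ v)))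
    ≡⟨ ∑-cong (splitsℕ k) (uncurry λ a b → ∑-splits-swap m (λ u v → f (b ∷ u) (a ∷ v))) ⟩
  ∑ (splitsℕ k) (uncurry λ a b → ∑ (splits m) (uncurry λ u v → f (b ∷ v) (a ∷ u)))
    ≡⟨ ∑-splits-∷ k m (flip f) ⟨
  ∑ (splits (k ∷ m)) (uncurry (flip f)) ∎
  where open ≡-Reasoning

∑-splits-assoc : {n : ℕ} (M : Mon n) (G : Mon n → Mon n → Mon n → ℤ) →
  ∑ (splits M) (uncurry λ x c → ∑ (splits x) (uncurry λ a b → G a b c))
  ≡ ∑ (splits M) (uncurry λ a y → ∑ (splits y) (uncurry (G a)))
∑-splits-assoc [] G = refl
∑-splits-assoc (k ∷ m) G = begin
  ∑ (splits (k ∷ m)) (uncurry λ x c → ∑ (splits x) (uncurry λ a b → G a b c))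
    ≡⟨ ∑-splits-∷ k m (λ x c → ∑ (splits x) (uncurry λ a b → G a b c)) ⟩
  ∑ (splitsℕ k) (uncurry λ x c → ∑ (splits m) (uncurry λ x′ c′ →
    ∑ (splits (x ∷ x′)) (uncurry λ a b → G a b (c ∷ c′))))
    ≡⟨ ∑-cong (splitsℕ k) (uncurry λ x c → ∑-cong (splits m) (uncurry λ x′ c′ →
         ∑-splits-∷ x x′ (λ a b → G a b (c ∷ c′)))) ⟩
  ∑ (splitsℕ k) (uncurry λ x c → ∑ (splits m) (uncurry λ x′ c′ →
    ∑ (splitsℕ x) (uncurry λ a b → ∑ (splits x′) (uncurry λ a′ b′ → G (a ∷ a′) (b ∷ b′) (c ∷ c′)))))
    ≡⟨ ∑-cong (splitsℕ k) (uncurry λ x c → ∑-comm (splits m) (splitsℕ x) _) ⟩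
  ∑ (splitsℕ k) (uncurry λ x c → ∑ (splitsℕ x) (uncurry λ a b →
    ∑ (splits m) (uncurry λ x′ c′ → ∑ (splits x′) (uncurry λ a′ b′ → G (a ∷ a′) (b ∷ b′) (c ∷ c′)))))
    ≡⟨ ∑-cong (splitsℕ k) (uncurry λ x c → ∑-cong (splitsℕ x) (uncurry λ a b →
         ∑-splits-assoc m (λ a′ b′ c′ → G (a ∷ a′) (b ∷ b′) (c ∷ c′)))) ⟩
  ∑ (splitsℕ k) (uncurry λ x c → ∑ (splitsℕ x) (uncurry λ a b →
    ∑ (splits m) (uncurry λ a′ y′ → ∑ (splits y′) (uncurry λ b′ c′ → G (a ∷ a′) (b ∷ b′) (c ∷ c′)))))
    ≡⟨ ∑-splitsℕ-assoc k (λ a b c → ∑ (splits m) (uncurry λ a′ y′ →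
         ∑ (splits y′) (uncurry λ b′ c′ → G (a ∷ a′) (b ∷ b′) (c ∷ c′)))) ⟩
  ∑ (splitsℕ k) (uncurry λ a y → ∑ (splitsℕ y) (uncurry λ b c →
    ∑ (splits m) (uncurry λ a′ y′ → ∑ (splits y′) (uncurry λ b′ c′ → G (a ∷ a′) (b ∷ b′) (c ∷ c′)))))
    ≡⟨ ∑-cong (splitsℕ k) (uncurry λ a y → ∑-comm (splitsℕ y) (splits m) _) ⟩
  ∑ (splitsℕ k) (uncurry λ a y → ∑ (splits m) (uncurry λ a′ y′ →
    ∑ (splitsℕ y) (uncurry λ b c → ∑ (splits y′) (uncurry λ b′ c′ → G (a ∷ a′) (b ∷ b′) (c ∷ c′)))))
    ≡⟨ ∑-cong (splitsℕ k) (uncurry λ a y → ∑-cong (splits m) (uncurry λ a′ y′ →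
         ∑-splits-∷ y y′ (G (a ∷ a′)))) ⟨
  ∑ (splitsℕ k) (uncurry λ a y → ∑ (splits m) (uncurry λ a′ y′ →
    ∑ (splits (y ∷ y′)) (uncurry (G (a ∷ a′)))))
    ≡⟨ ∑-splits-∷ k m (λ a y → ∑ (splits y) (uncurry (G a))) ⟨
  ∑ (splits (k ∷ m)) (uncurry λ a y → ∑ (splits y) (uncurry (G a))) ∎
  where open ≡-Reasoning

oneₚ-∷ : {n : ℕ} (a : ℕ) (u : Mon n) → oneₚ {suc n} (a ∷ u) ≡ δ₀ a * oneₚ u
oneₚ-∷ zero    u = sym (ℤᵖ.*-identityˡ (oneₚ u))
oneₚ-∷ (suc a) u = refl

∑-splits-oneₚ : {n : ℕ} (M : Mon n) (F : Mon n → ℤ) →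
  ∑ (splits M) (uncurry λ u v → oneₚ u * F v) ≡ F M
∑-splits-oneₚ [] F = trans (ℤᵖ.+-identityʳ _) (ℤᵖ.*-identityˡ (F []))
∑-splits-oneₚ (k ∷ m) F = begin
  ∑ (splits (k ∷ m)) (uncurry λ u v → oneₚ u * F v)
    ≡⟨ ∑-splits-∷ k m (λ u v → oneₚ u * F v) ⟩
  ∑ (splitsℕ k) (uncurry λ a b → ∑ (splits m) (uncurry λ u v → oneₚ (a ∷ u) * F (b ∷ v)))
    ≡⟨ ∑-cong (splitsℕ k) (uncurry λ a b → ∑-cong (splits m) (uncurry λ u v → begin
         oneₚ (a ∷ u) * F (b ∷ v)        ≡⟨ cong (_* F (b ∷ v)) (oneₚ-∷ a u) ⟩
         δ₀ a * oneₚ u * F (b ∷ v)       ≡⟨ ℤᵖ.*-assoc (δ₀ a) (oneₚ u) (F (b ∷ v)) ⟩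
         δ₀ a * (oneₚ u * F (b ∷ v))     ∎)) ⟩
  ∑ (splitsℕ k) (uncurry λ a b → ∑ (splits m) (uncurry λ u v → δ₀ a * (oneₚ u * F (b ∷ v))))
    ≡⟨ ∑-cong (splitsℕ k) (uncurry λ a b → *-distribˡ-∑ (splits m) (δ₀ a) _) ⟨
  ∑ (splitsℕ k) (uncurry λ a b → δ₀ a * ∑ (splits m) (uncurry λ u v → oneₚ u * F (b ∷ v)))
    ≡⟨ ∑-cong (splitsℕ k) (uncurry λ a b → cong (δ₀ a *_) (∑-splits-oneₚ m (λ v → F (b ∷ v)))) ⟩
  ∑ (splitsℕ k) (uncurry λ a b → δ₀ a * F (b ∷ m))
    ≡⟨ ∑-splitsℕ-δ₀ k (λ b → F (b ∷ m)) ⟩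
  F (k ∷ m) ∎
  where open ≡-Reasoning

-- The ring of power series

module _ {n : ℕ} where

  ≈ₚ-refl : {A : PS n} → A ≈ₚ A
  ≈ₚ-refl m = refl

  ≈ₚ-sym : {A B : PS n} → A ≈ₚ B → B ≈ₚ A
  ≈ₚ-sym e m = sym (e m)

  ≈ₚ-trans : {A B C : PS n} → A ≈ₚ B → B ≈ₚ C → A ≈ₚ C
  ≈ₚ-trans e f m = trans (e m) (f m)

  ≈ₚ-isEquivalence : IsEquivalence (_≈ₚ_ {n})
  ≈ₚ-isEquivalence = record { refl = ≈ₚ-refl ; sym = ≈ₚ-sym ; trans = ≈ₚ-trans }

≈ₚ-setoid : ℕ → Setoid _ _
≈ₚ-setoid n = record { isEquivalence = ≈ₚ-isEquivalence {n} }

module ≈ₚ-Reasoning {n : ℕ} = SetoidReasoning (≈ₚ-setoid n)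

module _ {n : ℕ} where

  *ₚ-cong : {A A′ B B′ : PS n} → A ≈ₚ A′ → B ≈ₚ B′ → (A *ₚ B) ≈ₚ (A′ *ₚ B′)
  *ₚ-cong eA eB m = ∑-cong (splits m) (uncurry λ u v → cong₂ _*_ (eA u) (eB v))

  *ₚ-congˡ : (A : PS n) {B B′ : PS n} → B ≈ₚ B′ → (A *ₚ B) ≈ₚ (A *ₚ B′)
  *ₚ-congˡ A = *ₚ-cong {A} ≈ₚ-refl

  *ₚ-congʳ : (B : PS n) {A A′ : PS n} → A ≈ₚ A′ → (A *ₚ B) ≈ₚ (A′ *ₚ B)
  *ₚ-congʳ B eA = *ₚ-cong {B = B} eA ≈ₚ-refl

  *ₚ-comm : (A B : PS n) → (A *ₚ B) ≈ₚ (B *ₚ A)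
  *ₚ-comm A B m = trans (∑-splits-swap m (λ u v → A u * B v))
                        (∑-cong (splits m) (uncurry λ u v → ℤᵖ.*-comm (A v) (B u)))

  *ₚ-identityˡ : (A : PS n) → (oneₚ *ₚ A) ≈ₚ A
  *ₚ-identityˡ A m = ∑-splits-oneₚ m A

  *ₚ-identityʳ : (A : PS n) → (A *ₚ oneₚ) ≈ₚ A
  *ₚ-identityʳ A = ≈ₚ-trans (*ₚ-comm A oneₚ) (*ₚ-identityˡ A)

  *ₚ-assoc : (A B C : PS n) → ((A *ₚ B) *ₚ C) ≈ₚ (A *ₚ (B *ₚ C))
  *ₚ-assoc A B C m = begin
    ∑ (splits m) (uncurry λ x c → ∑ (splits x) (uncurry λ a b → A a * B b) * C c)
      ≡⟨ ∑-cong (splits m) (uncurry λ x c → *-distribʳ-∑ (splits x) (C c) _) ⟩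
    ∑ (splits m) (uncurry λ x c → ∑ (splits x) (uncurry λ a b → A a * B b * C c))
      ≡⟨ ∑-splits-assoc m (λ a b c → A a * B b * C c) ⟩
    ∑ (splits m) (uncurry λ a y → ∑ (splits y) (uncurry λ b c → A a * B b * C c))
      ≡⟨ ∑-cong (splits m) (uncurry λ a y → ∑-cong (splits y) (uncurry λ b c → ℤᵖ.*-assoc (A a) (B b) (C c))) ⟩
    ∑ (splits m) (uncurry λ a y → ∑ (splits y) (uncurry λ b c → A a * (B b * C c)))
      ≡⟨ ∑-cong (splits m) (uncurry λ a y → *-distribˡ-∑ (splits y) (A a) _) ⟨
    ∑ (splits m) (uncurry λ a y → A a * ∑ (splits y) (uncurry λ b c → B b * C c)) ∎
    where open ≡-Reasoning

  +ₚ-congˡ : (A : PS n) {B B′ : PS n} → B ≈ₚ B′ → (A +ₚ B) ≈ₚ (A +ₚ B′)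
  +ₚ-congˡ A e m = cong (A m +_) (e m)

  *ₚ-distribʳ-+ₚ : (C A B : PS n) → ((A +ₚ B) *ₚ C) ≈ₚ ((A *ₚ C) +ₚ (B *ₚ C))
  *ₚ-distribʳ-+ₚ C A B m =
    trans (∑-cong (splits m) (uncurry λ u v → ℤᵖ.*-distribʳ-+ (C v) (A u) (B u)))
          (∑-distrib-+ (splits m) (uncurry λ u v → A u * C v) (uncurry λ u v → B u * C v))

  *ₚ-zeroˡ : (C : PS n) → (zeroₚ *ₚ C) ≈ₚ zeroₚ
  *ₚ-zeroˡ C m = ∑-0-∈ (splits m) (λ uv _ → ℤᵖ.*-zeroˡ (C (proj₂ uv)))

  *ₚ-interchange : (A B C D : PS n) → ((A *ₚ B) *ₚ (C *ₚ D)) ≈ₚ ((A *ₚ C) *ₚ (B *ₚ D))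
  *ₚ-interchange A B C D = begin
    (A *ₚ B) *ₚ (C *ₚ D)   ≈⟨ *ₚ-assoc A B (C *ₚ D) ⟩
    A *ₚ (B *ₚ (C *ₚ D))   ≈⟨ *ₚ-congˡ A (*ₚ-assoc B C D) ⟨
    A *ₚ ((B *ₚ C) *ₚ D)   ≈⟨ *ₚ-congˡ A (*ₚ-congʳ D (*ₚ-comm B C)) ⟩
    A *ₚ ((C *ₚ B) *ₚ D)   ≈⟨ *ₚ-congˡ A (*ₚ-assoc C B D) ⟩
    A *ₚ (C *ₚ (B *ₚ D))   ≈⟨ *ₚ-assoc A C (B *ₚ D) ⟨
    (A *ₚ C) *ₚ (B *ₚ D)   ∎
    where open ≈ₚ-Reasoning

  ∑ₚ : {I : Set} → List I → (I → PS n) → PS n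
  ∑ₚ xs f = foldr (λ i acc → f i +ₚ acc) zeroₚ xs

  ∑ₚ-cong : {I : Set} (xs : List I) {f g : I → PS n} → (∀ i → f i ≈ₚ g i) → ∑ₚ xs f ≈ₚ ∑ₚ xs g
  ∑ₚ-cong []       e m = refl
  ∑ₚ-cong (x ∷ xs) e m = cong₂ _+_ (e x m) (∑ₚ-cong xs e m)

  *ₚ-distribʳ-∑ₚ : {I : Set} (xs : List I) (f : I → PS n) (C : PS n) →
    (∑ₚ xs f *ₚ C) ≈ₚ ∑ₚ xs (λ i → f i *ₚ C)
  *ₚ-distribʳ-∑ₚ []       f C = *ₚ-zeroˡ C
  *ₚ-distribʳ-∑ₚ (x ∷ xs) f C m =
    trans (*ₚ-distribʳ-+ₚ C (f x) (∑ₚ xs f) m) (cong ((f x *ₚ C) m +_) (*ₚ-distribʳ-∑ₚ xs f C m))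

module IntegerPowers {n : ℕ} (R Rinv : PS n) (R*Rinv≈1 : (R *ₚ Rinv) ≈ₚ oneₚ) where
  open ≈ₚ-Reasoning

  R^ : ℤ → PS n
  R^ = zpowₚ R Rinv

  R^-cong : {a b : ℤ} → a ≡ b → R^ a ≈ₚ R^ b
  R^-cong refl = ≈ₚ-refl

  R-cancelˡ : (X : PS n) → (R *ₚ (Rinv *ₚ X)) ≈ₚ X
  R-cancelˡ X = begin
    R *ₚ (Rinv *ₚ X)  ≈⟨ *ₚ-assoc R Rinv X ⟨
    (R *ₚ Rinv) *ₚ X  ≈⟨ *ₚ-congʳ X R*Rinv≈1 ⟩
    oneₚ *ₚ X         ≈⟨ *ₚ-identityˡ X ⟩
    X                 ∎

  Rinv-cancelˡ : (X : PS n) → (Rinv *ₚ (R *ₚ X)) ≈ₚ X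
  Rinv-cancelˡ X = begin
    Rinv *ₚ (R *ₚ X)  ≈⟨ *ₚ-assoc Rinv R X ⟨
    (Rinv *ₚ R) *ₚ X  ≈⟨ *ₚ-congʳ X (≈ₚ-trans (*ₚ-comm Rinv R) R*Rinv≈1) ⟩
    oneₚ *ₚ X         ≈⟨ *ₚ-identityˡ X ⟩
    X                 ∎

  R^-suc : ∀ b → R^ (1ℤ + b) ≈ₚ (R *ₚ R^ b)
  R^-suc (ℤ.+ _)      = ≈ₚ-refl
  R^-suc -[1+ zero ]  = ≈ₚ-sym (R-cancelˡ oneₚ)
  R^-suc -[1+ suc k ] = ≈ₚ-sym (R-cancelˡ (R^ -[1+ k ]))

  R^-pred : ∀ b → R^ (-[1+ 0 ] + b) ≈ₚ (Rinv *ₚ R^ b)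
  R^-pred +0       = ≈ₚ-refl
  R^-pred +[1+ k ] = ≈ₚ-sym (Rinv-cancelˡ (R^ (ℤ.+ k)))
  R^-pred -[1+ k ] = ≈ₚ-refl

  R^-+ : ∀ a b → (R^ a *ₚ R^ b) ≈ₚ R^ (a + b)
  R^-+ +0 b = ≈ₚ-trans (*ₚ-identityˡ (R^ b)) (R^-cong (sym (ℤᵖ.+-identityˡ b)))
  R^-+ +[1+ k ] b = begin
    (R *ₚ R^ (ℤ.+ k)) *ₚ R^ b  ≈⟨ *ₚ-assoc R (R^ (ℤ.+ k)) (R^ b) ⟩
    R *ₚ (R^ (ℤ.+ k) *ₚ R^ b)  ≈⟨ *ₚ-congˡ R (R^-+ (ℤ.+ k) b) ⟩
    R *ₚ R^ (ℤ.+ k + b)        ≈⟨ R^-suc (ℤ.+ k + b) ⟨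
    R^ (1ℤ + (ℤ.+ k + b))      ≈⟨ R^-cong (ℤᵖ.+-assoc 1ℤ (ℤ.+ k) b) ⟨
    R^ (+[1+ k ] + b)          ∎
  R^-+ -[1+ zero ] b = begin
    (Rinv *ₚ oneₚ) *ₚ R^ b     ≈⟨ *ₚ-congʳ (R^ b) (*ₚ-identityʳ Rinv) ⟩
    Rinv *ₚ R^ b               ≈⟨ R^-pred b ⟨
    R^ (-[1+ 0 ] + b)          ∎
  R^-+ -[1+ suc k ] b = begin
    (Rinv *ₚ R^ -[1+ k ]) *ₚ R^ b  ≈⟨ *ₚ-assoc Rinv (R^ -[1+ k ]) (R^ b) ⟩
    Rinv *ₚ (R^ -[1+ k ] *ₚ R^ b)  ≈⟨ *ₚ-congˡ Rinv (R^-+ -[1+ k ] b) ⟩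
    Rinv *ₚ R^ (-[1+ k ] + b)      ≈⟨ R^-pred (-[1+ k ] + b) ⟨
    R^ (-[1+ 0 ] + (-[1+ k ] + b)) ≈⟨ R^-cong (ℤᵖ.+-assoc -[1+ 0 ] -[1+ k ] b) ⟨
    R^ (-[1+ suc k ] + b)          ∎

∑-upTo-sucʳ : (n : ℕ) (F : ℕ → ℤ) → ∑ (upTo (suc n)) F ≡ ∑ (upTo n) F + F n
∑-upTo-sucʳ n F = begin
  ∑ (upTo (suc n)) F         ≡⟨ cong (λ xs → ∑ xs F) (Listᵖ.upTo-∷ʳ n) ⟨
  ∑ (upTo n ++ [ n ]) F      ≡⟨ ∑-++ (upTo n) [ n ] F ⟩
  ∑ (upTo n) F + (F n + 0ℤ)  ≡⟨ cong (∑ (upTo n) F +_) (ℤᵖ.+-identityʳ (F n)) ⟩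
  ∑ (upTo n) F + F n         ∎
  where open ≡-Reasoning

∑-range-suc : (b : ℕ) (f : ℤ → ℤ) →
  ∑ (range (suc b)) f ≡ f -[1+ b ] + (∑ (range b) f + f +[1+ b ])
∑-range-suc b f = begin
  ∑ (range (suc b)) f
    ≡⟨ ∑-map (upTo (suc (suc b ℕ.+ suc b))) (at (suc b)) f ⟩
  ∑ (upTo (suc (suc b ℕ.+ suc b))) (f ∘ at (suc b))
    ≡⟨ ∑-upTo-suc (suc b ℕ.+ suc b) (f ∘ at (suc b)) ⟩
  f -[1+ b ] + ∑ (upTo (suc b ℕ.+ suc b)) (f ∘ at (suc b) ∘ suc)
    ≡⟨ cong (λ k → f -[1+ b ] + ∑ (upTo (suc k)) (f ∘ at (suc b) ∘ suc)) (ℕᵖ.+-suc b b) ⟩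
  f -[1+ b ] + ∑ (upTo (suc (suc (b ℕ.+ b)))) (f ∘ at (suc b) ∘ suc)
    ≡⟨ cong (f -[1+ b ] +_) (∑-upTo-sucʳ (suc (b ℕ.+ b)) (f ∘ at (suc b) ∘ suc)) ⟩
  f -[1+ b ] + (∑ (upTo (suc (b ℕ.+ b))) (f ∘ at (suc b) ∘ suc) + f (at (suc b) (suc (suc (b ℕ.+ b)))))
    ≡⟨ cong₂ (λ s t → f -[1+ b ] + (s + f t)) (∑-cong (upTo (suc (b ℕ.+ b))) (cong f ∘ at-suc))
             at-last ⟩
  f -[1+ b ] + (∑ (upTo (suc (b ℕ.+ b))) (f ∘ at b) + f +[1+ b ])
    ≡⟨ cong (λ s → f -[1+ b ] + (s + f +[1+ b ])) (∑-map (upTo (suc (b ℕ.+ b))) (at b) f) ⟨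
  f -[1+ b ] + (∑ (range b) f + f +[1+ b ]) ∎
  where
  open ≡-Reasoning
  at : ℕ → ℕ → ℤ
  at c i = ℤ.+ i - ℤ.+ c
  at-suc : (i : ℕ) → at (suc b) (suc i) ≡ at b i
  at-suc i = trans (ℤᵖ.[1+m]⊖[1+n]≡m⊖n i b) (sym (ℤᵖ.m-n≡m⊖n i b))
  at-last : at (suc b) (suc (suc (b ℕ.+ b))) ≡ +[1+ b ]
  at-last = begin
    ℤ.+ suc (suc (b ℕ.+ b)) - +[1+ b ]  ≡⟨ ℤᵖ.[1+m]⊖[1+n]≡m⊖n (suc (b ℕ.+ b)) b ⟩
    suc (b ℕ.+ b) ℤ.⊖ b                 ≡⟨ ℤᵖ.⊖-≥ (ℕᵖ.m≤n+m b (suc b)) ⟩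
    ℤ.+ (suc b ℕ.+ b ∸ b)               ≡⟨ cong ℤ.+_ (ℕᵖ.m+n∸n≡m (suc b) b) ⟩
    +[1+ b ]                            ∎

SupportedIn : ℕ → (ℤ → ℤ) → Set
SupportedIn b f = ∀ j → b ℕ.< ∣ j ∣ → f j ≡ 0ℤ

∑-range-extend : (f : ℤ → ℤ) {b : ℕ} (N : ℕ) → SupportedIn b f → b ℕ.≤ N → ∑ (range N) f ≡ ∑ (range b) f
∑-range-extend f zero _ z≤n = refl
∑-range-extend f {b} (suc N) f⊆b b≤1+N with ℕᵖ.m≤n⇒m<n∨m≡n b≤1+N
... | inj₂ refl = refl
... | inj₁ (s≤s b≤N) = begin
  ∑ (range (suc N)) f                            ≡⟨ ∑-range-suc N f ⟩
  f -[1+ N ] + (∑ (range N) f + f +[1+ N ])      ≡⟨ cong₂ (λ x y → x + (∑ (range N) f + y))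
                                                          (f⊆b -[1+ N ] (s≤s b≤N)) (f⊆b +[1+ N ] (s≤s b≤N)) ⟩
  0ℤ + (∑ (range N) f + 0ℤ)                      ≡⟨ trans (ℤᵖ.+-identityˡ _) (ℤᵖ.+-identityʳ _) ⟩
  ∑ (range N) f                                  ≡⟨ ∑-range-extend f N f⊆b b≤N ⟩
  ∑ (range b) f                                  ∎
  where open ≡-Reasoning

∑-range-irrelevant : (f : ℤ → ℤ) {b b′ : ℕ} → SupportedIn b f → SupportedIn b′ f →
  ∑ (range b) f ≡ ∑ (range b′) f
∑-range-irrelevant f {b} {b′} f⊆b f⊆b′ =
  trans (sym (∑-range-extend f (b ℕ.⊔ b′) f⊆b (ℕᵖ.m≤m⊔n b b′)))
        (∑-range-extend f (b ℕ.⊔ b′) f⊆b′ (ℕᵖ.m≤n⊔m b b′))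

∑-range-neg : (f : ℤ → ℤ) (b : ℕ) → ∑ (range b) (f ∘ -_) ≡ ∑ (range b) f
∑-range-neg f zero = refl
∑-range-neg f (suc b) = begin
  ∑ (range (suc b)) (f ∘ -_)                          ≡⟨ ∑-range-suc b (f ∘ -_) ⟩
  f +[1+ b ] + (∑ (range b) (f ∘ -_) + f -[1+ b ])    ≡⟨ cong (λ s → f +[1+ b ] + (s + f -[1+ b ])) (∑-range-neg f b) ⟩
  f +[1+ b ] + (∑ (range b) f + f -[1+ b ])           ≡⟨ ℤᵖ.+-comm (f +[1+ b ]) _ ⟩
  (∑ (range b) f + f -[1+ b ]) + f +[1+ b ]           ≡⟨ cong (_+ f +[1+ b ]) (ℤᵖ.+-comm (∑ (range b) f) _) ⟩
  (f -[1+ b ] + ∑ (range b) f) + f +[1+ b ]           ≡⟨ ℤᵖ.+-assoc (f -[1+ b ]) _ _ ⟩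
  f -[1+ b ] + (∑ (range b) f + f +[1+ b ])           ≡⟨ ∑-range-suc b f ⟨
  ∑ (range (suc b)) f                                 ∎
  where open ≡-Reasoning

deg : {n : ℕ} → Mon n → ℕ
deg []      = 0
deg (k ∷ m) = k ℕ.+ deg m

deg-zeroMon : (n : ℕ) → deg (zeroMon {n}) ≡ 0
deg-zeroMon zero    = refl
deg-zeroMon (suc n) = deg-zeroMon n

deg-unitMon : {n : ℕ} (i : Fin n) → deg (unitMon i) ≡ 1
deg-unitMon {suc n} Fin.zero    = cong suc (deg-zeroMon n)
deg-unitMon {suc n} (Fin.suc i) = deg-unitMon i

∈-splitsℕ⇒+≡ : (k : ℕ) {ab : ℕ × ℕ} → ab ∈ splitsℕ k → proj₁ ab ℕ.+ proj₂ ab ≡ k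
∈-splitsℕ⇒+≡ k ab∈ with ∈ᵖ.∈-map⁻ (λ i → i , k ∸ i) ab∈
... | i , i∈ , refl with ∈ᵖ.∈-upTo⁻ i∈
... | s≤s i≤k = ℕᵖ.m+[n∸m]≡n i≤k

∈-splits⇒deg+deg≡deg : {n : ℕ} (M : Mon n) {uv : Mon n × Mon n} → uv ∈ splits M →
  deg (proj₁ uv) ℕ.+ deg (proj₂ uv) ≡ deg M
∈-splits⇒deg+deg≡deg [] (here refl) = refl
∈-splits⇒deg+deg≡deg (k ∷ m) uv∈ with find (∈ᵖ.∈-concatMap⁻ _ {xs = splitsℕ k} uv∈)
... | (a , b) , ab∈ , uv∈′ with ∈ᵖ.∈-map⁻ _ uv∈′
... | (u , v) , uv∈m , refl = begin
  (a ℕ.+ deg u) ℕ.+ (b ℕ.+ deg v)  ≡⟨ CommSemigroupProperties.interchange ℕᵖ.+-commutativeSemigroup a (deg u) b (deg v) ⟩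
  (a ℕ.+ b) ℕ.+ (deg u ℕ.+ deg v)  ≡⟨ cong₂ ℕ._+_ (∈-splitsℕ⇒+≡ k ab∈) (∈-splits⇒deg+deg≡deg m uv∈m) ⟩
  k ℕ.+ deg m                      ∎
  where open ≡-Reasoning

≤-maxℕ : {X : Set} (ys : List X) (h : X → ℕ) {y : X} → y ∈ ys → h y ℕ.≤ maxℕ (map h ys)
≤-maxℕ (y ∷ ys) h (here refl) = ℕᵖ.m≤m⊔n (h y) _
≤-maxℕ (y ∷ ys) h (there y∈)  = ℕᵖ.m≤n⇒m≤o⊔n (h y) (≤-maxℕ ys h y∈)

module _ {n : ℕ} where

  infix 25 _[z^_]
  _[z^_] : LS n → ℤ → PS n
  (X [z^ j ]) u = coef X u j

  maxOverSplits : (Mon n → ℕ) → Mon n → ℕ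
  maxOverSplits b M = maxℕ (map (b ∘ proj₁) (splits M))

  ≤-maxOverSplits : (b : Mon n → ℕ) (M : Mon n) {uv : Mon n × Mon n} → uv ∈ splits M →
    b (proj₁ uv) ℕ.≤ maxOverSplits b M
  ≤-maxOverSplits b M = ≤-maxℕ (splits M) (b ∘ proj₁)

  SupportedInₚ : (Mon n → ℕ) → (ℤ → PS n) → Set
  SupportedInₚ b F = ∀ u → SupportedIn (b u) (λ i → F i u)

  ∑ᵣ : (ℤ → PS n) → (Mon n → ℕ) → PS n
  ∑ᵣ F b u = ∑ (range (b u)) (λ i → F i u)

  ∑ᵣ-cong : {F G : ℤ → PS n} (b : Mon n → ℕ) → (∀ i → F i ≈ₚ G i) → ∑ᵣ F b ≈ₚ ∑ᵣ G b
  ∑ᵣ-cong b e u = ∑-cong (range (b u)) (λ i → e i u)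

  ∑ᵣ-irrelevant : (F : ℤ → PS n) {b b′ : Mon n → ℕ} → SupportedInₚ b F → SupportedInₚ b′ F →
    ∑ᵣ F b ≈ₚ ∑ᵣ F b′
  ∑ᵣ-irrelevant F F⊆b F⊆b′ u = ∑-range-irrelevant (λ i → F i u) (F⊆b u) (F⊆b′ u)

  ∑ᵣ-neg : (F : ℤ → PS n) (b : Mon n → ℕ) → ∑ᵣ F b ≈ₚ ∑ᵣ (F ∘ -_) b
  ∑ᵣ-neg F b u = sym (∑-range-neg (λ i → F i u) (b u))

  SupportedInₚ-cong : {F G : ℤ → PS n} (b : Mon n → ℕ) → (∀ i → F i ≈ₚ G i) →
    SupportedInₚ b F → SupportedInₚ b G
  SupportedInₚ-cong b e F⊆b u i lt = trans (sym (e i u)) (F⊆b u i lt)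

  SupportedInₚ-neg : (F : ℤ → PS n) (b : Mon n → ℕ) → SupportedInₚ b F → SupportedInₚ b (F ∘ -_)
  SupportedInₚ-neg F b F⊆b u i lt = F⊆b u (- i) (subst (b u ℕ.<_) (sym (ℤᵖ.∣-i∣≡∣i∣ i)) lt)

  SupportedInₚ-*ₚ : (F G : ℤ → PS n) (b : Mon n → ℕ) → SupportedInₚ b F →
    SupportedInₚ (maxOverSplits b) (λ i → F i *ₚ G i)
  SupportedInₚ-*ₚ F G b F⊆b M i lt = ∑-0-∈ (splits M) λ uv uv∈ →
    ≡0⇒*≡0 (G i (proj₂ uv)) (F⊆b (proj₁ uv) i (ℕᵖ.≤-<-trans (≤-maxOverSplits b M uv∈) lt))

  ∑-splits-∑-range : (F G : ℤ → PS n) (b : Mon n → ℕ) → SupportedInₚ b F → (M : Mon n) →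
    ∑ (splits M) (uncurry λ u v → ∑ (range (b u)) (λ i → F i u * G i v))
    ≡ ∑ᵣ (λ i → F i *ₚ G i) (maxOverSplits b) M
  ∑-splits-∑-range F G b F⊆b M = begin
    ∑ (splits M) (uncurry λ u v → ∑ (range (b u)) (λ i → F i u * G i v))
      ≡⟨ ∑-cong-∈ (splits M) (λ uv uv∈ → sym (∑-range-extend (λ i → F i (proj₁ uv) * G i (proj₂ uv))
           (maxOverSplits b M) (λ i lt → ≡0⇒*≡0 (G i (proj₂ uv)) (F⊆b (proj₁ uv) i lt))
           (≤-maxOverSplits b M uv∈))) ⟩
    ∑ (splits M) (uncurry λ u v → ∑ (range (maxOverSplits b M)) (λ i → F i u * G i v))
      ≡⟨ ∑-comm (splits M) (range (maxOverSplits b M)) _ ⟩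
    ∑ᵣ (λ i → F i *ₚ G i) (maxOverSplits b) M ∎
    where open ≡-Reasoning

  ⊗-[z^] : (A B : LS n) → WF A → (k : ℤ) →
    (A ⊗ B) [z^ k ] ≈ₚ ∑ᵣ (λ i → A [z^ i ] *ₚ B [z^ k - i ]) (maxOverSplits (bnd A))
  ⊗-[z^] A B wfA k = ∑-splits-∑-range (A [z^_]) (λ i → B [z^ k - i ]) (bnd A) wfA

  *ₚ-distribʳ-∑ᵣ : (F : ℤ → PS n) (b : Mon n → ℕ) (C : PS n) → SupportedInₚ b F →
    (∑ᵣ F b *ₚ C) ≈ₚ ∑ᵣ (λ i → F i *ₚ C) (maxOverSplits b)
  *ₚ-distribʳ-∑ᵣ F b C F⊆b M =
    trans (∑-cong (splits M) (uncurry λ u v → *-distribʳ-∑ (range (b u)) (C v) (λ i → F i u)))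
          (∑-splits-∑-range F (λ _ → C) b F⊆b M)

module _ {n : ℕ} where

  ≈-refl : {X : LS n} → X ≈ X
  ≈-refl u j = refl

  ≈-sym : {X Y : LS n} → X ≈ Y → Y ≈ X
  ≈-sym e u j = sym (e u j)

  ≈-trans : {X Y Z : LS n} → X ≈ Y → Y ≈ Z → X ≈ Z
  ≈-trans e f u j = trans (e u j) (f u j)

  ≈-isEquivalence : IsEquivalence (_≈_ {n})
  ≈-isEquivalence = record
    { refl  = λ {X} → ≈-refl {X = X}
    ; sym   = λ {X} {Y} → ≈-sym {X} {Y}
    ; trans = λ {X} {Y} {Z} → ≈-trans {X} {Y} {Z}
    }

≈-setoid : ℕ → Setoid _ _
≈-setoid n = record { isEquivalence = ≈-isEquivalence {n} }

module _ {n : ℕ} where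

  ∑L : {I : Set} → List I → (I → LS n) → LS n
  ∑L xs f = foldr (λ i acc → f i ⊕ acc) zeroL xs

  ∑L-cong : {I : Set} (xs : List I) {f g : I → LS n} → (∀ i → f i ≈ g i) → ∑L xs f ≈ ∑L xs g
  ∑L-cong []       e u j = refl
  ∑L-cong (x ∷ xs) e u j = cong₂ _+_ (e x u j) (∑L-cong xs e u j)

  posPart-coef-cong : (X X′ : LS n) (u : Mon n) (j : ℤ) →
    coef X u j ≡ coef X′ u j → coef (posPart X) u j ≡ coef (posPart X′) u j
  posPart-coef-cong X X′ u j e with does (0ℤ ℤ.≤? j)
  ... | true  = e
  ... | false = refl

  negPart-coef-cong : (X X′ : LS n) (u : Mon n) (j : ℤ) →
    coef X u j ≡ coef X′ u j → coef (negPart X) u j ≡ coef (negPart X′) u j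
  negPart-coef-cong X X′ u j e with does (j ℤ.≤? 0ℤ)
  ... | true  = e
  ... | false = refl

  posPart-cong : {X X′ : LS n} → X ≈ X′ → posPart X ≈ posPart X′
  posPart-cong {X} {X′} e u j = posPart-coef-cong X X′ u j (e u j)

  negPart-cong : {X X′ : LS n} → X ≈ X′ → negPart X ≈ negPart X′
  negPart-cong {X} {X′} e u j = negPart-coef-cong X X′ u j (e u j)

  ⊗-congˡ : (A : LS n) {B B′ : LS n} → B ≈ B′ → (A ⊗ B) ≈ (A ⊗ B′)
  ⊗-congˡ A e m j = ∑-cong (splits m) (uncurry λ u v → ∑-cong (range (bnd A u))
    (λ i → cong (coef A u i *_) (e v (j - i))))

  embed-⊗-[z^] : (P : PS n) (X : LS n) (j : ℤ) → (embed P ⊗ X) [z^ j ] ≈ₚ (P *ₚ X [z^ j ])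
  embed-⊗-[z^] P X j m = ∑-cong (splits m) (uncurry λ u v →
    trans (ℤᵖ.+-identityʳ _) (cong (λ t → P u * coef X v t) (ℤᵖ.+-identityʳ j)))

  record AgreeBelow (d : ℕ) (X Y : LS n) : Set where
    constructor agreeBelow
    field agree : ∀ u → deg u ℕ.< d → ∀ j → coef X u j ≡ coef Y u j
  open AgreeBelow public

  AgreeBelow-zero : (X Y : LS n) → AgreeBelow 0 X Y
  AgreeBelow-zero X Y = agreeBelow λ u ()

  AgreeBelow-pred : {d : ℕ} {X Y : LS n} → AgreeBelow (suc d) X Y → AgreeBelow d X Y
  AgreeBelow-pred a = agreeBelow λ u lt → agree a u (ℕᵖ.m≤n⇒m≤1+n lt)

  ≈⇒AgreeBelow : (d : ℕ) {X Y : LS n} → X ≈ Y → AgreeBelow d X Y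
  ≈⇒AgreeBelow d e = agreeBelow λ u _ → e u

  AgreeBelow-all⇒≈ : {X Y : LS n} → (∀ d → AgreeBelow d X Y) → X ≈ Y
  AgreeBelow-all⇒≈ a u = agree (a (suc (deg u))) u (ℕᵖ.n<1+n (deg u))

  AgreeBelow-⊕ : {d : ℕ} {X X′ Y Y′ : LS n} → AgreeBelow d X X′ → AgreeBelow d Y Y′ →
    AgreeBelow d (X ⊕ Y) (X′ ⊕ Y′)
  AgreeBelow-⊕ a b = agreeBelow λ u lt j → cong₂ _+_ (agree a u lt j) (agree b u lt j)

  AgreeBelow-∑L : {d : ℕ} {I : Set} (xs : List I) {f g : I → LS n} →
    (∀ i → AgreeBelow d (f i) (g i)) → AgreeBelow d (∑L xs f) (∑L xs g)
  AgreeBelow-∑L {d} []       a = ≈⇒AgreeBelow d (≈-refl {X = zeroL})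
  AgreeBelow-∑L     (x ∷ xs) a = AgreeBelow-⊕ (a x) (AgreeBelow-∑L xs a)

  AgreeBelow-posPart : {d : ℕ} {X X′ : LS n} → AgreeBelow d X X′ → AgreeBelow d (posPart X) (posPart X′)
  AgreeBelow-posPart {X = X} {X′} a = agreeBelow λ u lt j → posPart-coef-cong X X′ u j (agree a u lt j)

  AgreeBelow-negPart : {d : ℕ} {X X′ : LS n} → AgreeBelow d X X′ → AgreeBelow d (negPart X) (negPart X′)
  AgreeBelow-negPart {X = X} {X′} a = agreeBelow λ u lt j → negPart-coef-cong X X′ u j (agree a u lt j)

  AgreeBelow-⊗ : {d : ℕ} (A A′ B B′ : LS n) → WF A → WF A′ →
    AgreeBelow d A A′ → AgreeBelow d B B′ → AgreeBelow d (A ⊗ B) (A′ ⊗ B′)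
  AgreeBelow-⊗ {d} A A′ B B′ wfA wfA′ a b = agreeBelow product-agrees
    where
    open ≡-Reasoning
    term : (j : ℤ) (X Y : LS n) (i : ℤ) → PS n
    term j X Y i = X [z^ i ] *ₚ Y [z^ j - i ]

    terms-agree : ∀ u → deg u ℕ.< d → ∀ j i → term j A B i u ≡ term j A′ B′ i u
    terms-agree u lt j i = ∑-cong-∈ (splits u) λ vw vw∈ →
      let deg-vw = ∈-splits⇒deg+deg≡deg u vw∈ in
      cong₂ _*_ (agree a (proj₁ vw) (ℕᵖ.≤-<-trans (subst (_ ℕ.≤_) deg-vw (ℕᵖ.m≤m+n _ _)) lt) i)
                (agree b (proj₂ vw) (ℕᵖ.≤-<-trans (subst (_ ℕ.≤_) deg-vw (ℕᵖ.m≤n+m _ _)) lt) (j - i))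

    -- The defining sums of A ⊗ B and A′ ⊗ B′ are cut off at different bounds.
    product-agrees : ∀ u → deg u ℕ.< d → ∀ j → coef (A ⊗ B) u j ≡ coef (A′ ⊗ B′) u j
    product-agrees u lt j = begin
      coef (A ⊗ B) u j
        ≡⟨ ⊗-[z^] A B wfA j u ⟩
      ∑ (range (maxOverSplits (bnd A) u)) (λ i → term j A B i u)
        ≡⟨ ∑-cong (range (maxOverSplits (bnd A) u)) (terms-agree u lt j) ⟩
      ∑ (range (maxOverSplits (bnd A) u)) (λ i → term j A′ B′ i u)
        ≡⟨ ∑-range-irrelevant (λ i → term j A′ B′ i u)
             (λ i lt′ → trans (sym (terms-agree u lt j i))
                              (SupportedInₚ-*ₚ (A [z^_]) (λ i → B [z^ j - i ]) (bnd A) wfA u i lt′))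
             (SupportedInₚ-*ₚ (A′ [z^_]) (λ i → B′ [z^ j - i ]) (bnd A′) wfA′ u) ⟩
      ∑ (range (maxOverSplits (bnd A′) u)) (λ i → term j A′ B′ i u)
        ≡⟨ ⊗-[z^] A′ B′ wfA′ j u ⟨
      coef (A′ ⊗ B′) u j ∎

  AgreeBelow-powL : {d : ℕ} (X X′ : LS n) → WF X → WF X′ → AgreeBelow d X X′ →
    (k : ℕ) → AgreeBelow d (powL X k) (powL X′ k)
  AgreeBelow-powL {d} X X′ wfX wfX′ a zero    = ≈⇒AgreeBelow d (≈-refl {X = oneL})
  AgreeBelow-powL     X X′ wfX wfX′ a (suc k) =
    AgreeBelow-⊗ X X′ _ _ wfX wfX′ a (AgreeBelow-powL X X′ wfX wfX′ a k)

  powL-cong : (X X′ : LS n) → WF X → WF X′ → X ≈ X′ → (k : ℕ) → powL X k ≈ powL X′ k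
  powL-cong X X′ wfX wfX′ e k =
    AgreeBelow-all⇒≈ (λ d → AgreeBelow-powL X X′ wfX wfX′ (≈⇒AgreeBelow d e) k)

  AgreeBelow-varₚ-⊗ : {d : ℕ} (k : Fin n) {Y Y′ : LS n} → AgreeBelow d Y Y′ →
    AgreeBelow (suc d) (embed (varₚ k) ⊗ Y) (embed (varₚ k) ⊗ Y′)
  AgreeBelow-varₚ-⊗ {d} k {Y} {Y′} a = agreeBelow λ u lt j → begin
    coef (embed (varₚ k) ⊗ Y) u j   ≡⟨ embed-⊗-[z^] (varₚ k) Y j u ⟩
    (varₚ k *ₚ Y [z^ j ]) u          ≡⟨ ∑-cong-∈ (splits u) (term-agrees u lt j) ⟩
    (varₚ k *ₚ Y′ [z^ j ]) u         ≡⟨ embed-⊗-[z^] (varₚ k) Y′ j u ⟨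
    coef (embed (varₚ k) ⊗ Y′) u j  ∎
    where
    open ≡-Reasoning
    -- Only the split u = unitMon k + w contributes, and then deg w < d.
    term-agrees : ∀ u → deg u ℕ.< suc d → ∀ j (vw : Mon n × Mon n) → vw ∈ splits u →
      varₚ k (proj₁ vw) * coef Y (proj₂ vw) j ≡ varₚ k (proj₁ vw) * coef Y′ (proj₂ vw) j
    term-agrees u lt j (v , w) vw∈ with ≡-dec ℕ._≟_ v (unitMon k)
    ... | no  _    = refl
    ... | yes refl = cong (1ℤ *_) (agree a w (ℕᵖ.+-cancelˡ-< 1 (deg w) d
                       (subst (ℕ._< suc d) (trans (sym (∈-splits⇒deg+deg≡deg u vw∈))
                                                  (cong (ℕ._+ deg w) (deg-unitMon k))) lt)) j)

-- The substitution z ↦ R/z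

[z^]-cong : {n : ℕ} (X : LS n) {a b : ℤ} → a ≡ b → X [z^ a ] ≈ₚ X [z^ b ]
[z^]-cong X refl = ≈ₚ-refl

module Substitution {n : ℕ} (R Rinv : PS n) (R*Rinv≈1 : (R *ₚ Rinv) ≈ₚ oneₚ) where
  open IntegerPowers R Rinv R*Rinv≈1

  σ : LS n → LS n
  σ X = substRz X R Rinv

  σ-[z^] : (X : LS n) (j : ℤ) → σ X [z^ j ] ≈ₚ (X [z^ - j ] *ₚ R^ (- j))
  σ-[z^] X j = ≈ₚ-refl

  WF-σ : (X : LS n) → WF X → WF (σ X)
  WF-σ X wfX = SupportedInₚ-cong (maxOverSplits (bnd X)) (λ i → ≈ₚ-sym (σ-[z^] X i))
    (SupportedInₚ-*ₚ (X [z^_] ∘ -_) (R^ ∘ -_) (bnd X) (SupportedInₚ-neg (X [z^_]) (bnd X) wfX))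

  σ-cong : {X Y : LS n} → X ≈ Y → σ X ≈ σ Y
  σ-cong e M j = *ₚ-congʳ (R^ (- j)) (λ u → e u (- j)) M

  σ-⊕ : (X Y : LS n) → σ (X ⊕ Y) ≈ (σ X ⊕ σ Y)
  σ-⊕ X Y M j = *ₚ-distribʳ-+ₚ (R^ (- j)) (X [z^ - j ]) (Y [z^ - j ]) M

  σ-∑L : {I : Set} (xs : List I) (f : I → LS n) → σ (∑L xs f) ≈ ∑L xs (σ ∘ f)
  σ-∑L []       f M j = *ₚ-zeroˡ (R^ (- j)) M
  σ-∑L (x ∷ xs) f M j = trans (σ-⊕ (f x) (∑L xs f) M j) (cong (coef (σ (f x)) M j +_) (σ-∑L xs f M j))

  σ-posPart : (X : LS n) → σ (posPart X) ≈ negPart (σ X)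
  σ-posPart X M +0         = refl
  σ-posPart X M +[1+ k ]   = *ₚ-zeroˡ (R^ -[1+ k ]) M
  σ-posPart X M -[1+ k ]   = refl

  σ-negPart : (X : LS n) → σ (negPart X) ≈ posPart (σ X)
  σ-negPart X M +0         = refl
  σ-negPart X M +[1+ k ]   = refl
  σ-negPart X M -[1+ k ]   = *ₚ-zeroˡ (R^ +[1+ k ]) M

  σ-embed : (P : PS n) → σ (embed P) ≈ embed P
  σ-embed P M +0         = *ₚ-identityʳ P M
  σ-embed P M +[1+ k ]   = *ₚ-zeroˡ (R^ -[1+ k ]) M
  σ-embed P M -[1+ k ]   = *ₚ-zeroˡ (R^ +[1+ k ]) M

  σ-embed-⊗ : (P : PS n) (X : LS n) → σ (embed P ⊗ X) ≈ (embed P ⊗ σ X)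
  σ-embed-⊗ P X M j = coefficients-agree M
    where
    open ≈ₚ-Reasoning
    coefficients-agree : σ (embed P ⊗ X) [z^ j ] ≈ₚ (embed P ⊗ σ X) [z^ j ]
    coefficients-agree = begin
      (embed P ⊗ X) [z^ - j ] *ₚ R^ (- j)  ≈⟨ *ₚ-congʳ (R^ (- j)) (embed-⊗-[z^] P X (- j)) ⟩
      (P *ₚ X [z^ - j ]) *ₚ R^ (- j)       ≈⟨ *ₚ-assoc P (X [z^ - j ]) (R^ (- j)) ⟩
      P *ₚ σ X [z^ j ]                     ≈⟨ embed-⊗-[z^] P (σ X) j ⟨
      (embed P ⊗ σ X) [z^ j ]              ∎

  σ-zL : σ zL ≈ shift (- 1ℤ) (embed R)
  σ-zL M +0               = *ₚ-zeroˡ (R^ +0) M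
  σ-zL M +[1+ k ]         = *ₚ-zeroˡ (R^ -[1+ k ]) M
  σ-zL M -[1+ zero ]      = trans (*ₚ-identityˡ (R *ₚ oneₚ) M) (*ₚ-identityʳ R M)
  σ-zL M -[1+ suc k ]     = *ₚ-zeroˡ (R^ +[1+ suc k ]) M

  σ-z⁻¹R : σ (shift (- 1ℤ) (embed R)) ≈ zL
  σ-z⁻¹R M +0               = *ₚ-zeroˡ (R^ +0) M
  σ-z⁻¹R M +[1+ zero ]      = R-cancelˡ oneₚ M
  σ-z⁻¹R M +[1+ suc k ]     = *ₚ-zeroˡ (R^ -[1+ suc k ]) M
  σ-z⁻¹R M -[1+ k ]         = *ₚ-zeroˡ (R^ +[1+ k ]) M

  σ-⊗ : (A B : LS n) → WF A → σ (A ⊗ B) ≈ (σ A ⊗ σ B)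
  σ-⊗ A B wfA M j = sym (coefficients-agree M)
    where
    open ≈ₚ-Reasoning
    open +-*-Solver

    product : ℤ → PS n
    product i = A [z^ i ] *ₚ B [z^ - j - i ]

    σ-product : ℤ → PS n
    σ-product i = σ A [z^ i ] *ₚ σ B [z^ j - i ]

    b : Mon n → ℕ
    b = maxOverSplits (bnd (σ A))

    σ-product-neg : ∀ i → σ-product (- i) ≈ₚ (product i *ₚ R^ (- j))
    σ-product-neg i = begin
      (A [z^ - - i ] *ₚ R^ (- - i)) *ₚ (B [z^ - (j - - i) ] *ₚ R^ (- (j - - i)))
        ≈⟨ *ₚ-cong (*ₚ-cong ([z^]-cong A neg-neg) (R^-cong neg-neg))
                   (*ₚ-cong ([z^]-cong B index) (R^-cong index)) ⟩
      (A [z^ i ] *ₚ R^ i) *ₚ (B [z^ - j - i ] *ₚ R^ (- j - i))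
        ≈⟨ *ₚ-interchange (A [z^ i ]) (R^ i) (B [z^ - j - i ]) (R^ (- j - i)) ⟩
      product i *ₚ (R^ i *ₚ R^ (- j - i))
        ≈⟨ *ₚ-congˡ (product i) (R^-+ i (- j - i)) ⟩
      product i *ₚ R^ (i + (- j - i))
        ≈⟨ *ₚ-congˡ (product i) (R^-cong (solve 2 (λ j i → i :+ (:- j :- i) := :- j) refl j i)) ⟩
      product i *ₚ R^ (- j) ∎
      where
      neg-neg : - - i ≡ i
      neg-neg = ℤᵖ.neg-involutive i
      index : - (j - - i) ≡ - j - i
      index = solve 2 (λ j i → :- (j :- :- i) := :- j :- i) refl j i

    coefficients-agree : (σ A ⊗ σ B) [z^ j ] ≈ₚ σ (A ⊗ B) [z^ j ]
    coefficients-agree = begin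
      (σ A ⊗ σ B) [z^ j ]
        ≈⟨ ⊗-[z^] (σ A) (σ B) (WF-σ A wfA) j ⟩
      ∑ᵣ σ-product b
        ≈⟨ ∑ᵣ-neg σ-product b ⟩
      ∑ᵣ (σ-product ∘ -_) b
        ≈⟨ ∑ᵣ-cong b σ-product-neg ⟩
      ∑ᵣ (λ i → product i *ₚ R^ (- j)) b
        ≈⟨ ∑ᵣ-irrelevant (λ i → product i *ₚ R^ (- j))
             (SupportedInₚ-cong b σ-product-neg
               (SupportedInₚ-neg σ-product b
                 (SupportedInₚ-*ₚ (σ A [z^_]) (λ i → σ B [z^ j - i ]) (bnd (σ A)) (WF-σ A wfA))))
             (SupportedInₚ-*ₚ product (λ _ → R^ (- j)) (maxOverSplits (bnd A)) product-supported) ⟩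
      ∑ᵣ (λ i → product i *ₚ R^ (- j)) (maxOverSplits (maxOverSplits (bnd A)))
        ≈⟨ *ₚ-distribʳ-∑ᵣ product (maxOverSplits (bnd A)) (R^ (- j)) product-supported ⟨
      ∑ᵣ product (maxOverSplits (bnd A)) *ₚ R^ (- j)
        ≈⟨ *ₚ-congʳ (R^ (- j)) (⊗-[z^] A B wfA (- j)) ⟨
      σ (A ⊗ B) [z^ j ] ∎
      where
      product-supported : SupportedInₚ (maxOverSplits (bnd A)) product
      product-supported = SupportedInₚ-*ₚ (A [z^_]) (λ i → B [z^ - j - i ]) (bnd A) wfA

  σ-powL : (X : LS n) → WF X → (k : ℕ) → σ (powL X k) ≈ powL (σ X) k
  σ-powL X wfX zero          = σ-embed oneₚ
  σ-powL X wfX (suc k) M j   =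
    trans (σ-⊗ X (powL X k) wfX M j) (⊗-congˡ (σ X) {σ (powL X k)} {powL (σ X) k} (σ-powL X wfX k) M j)

-- The system

module System (p : ℕ) (R Rinv : PS (suc p)) (R*Rinv≈1 : (R *ₚ Rinv) ≈ₚ oneₚ) where
  open IntegerPowers R Rinv R*Rinv≈1
  open Substitution R Rinv R*Rinv≈1

  weighted : (LS (suc p) → LS (suc p)) → LS (suc p) → LS (suc p)
  weighted cut X = ∑L (allFin p) (λ i → embed (gW i) ⊗ cut (powL X (toℕ i)))

  yTerm : LS (suc p) → LS (suc p)
  yTerm X = embed yW ⊗ weighted id X

  -- Chosen so that EqQcirc R Qc Qb and EqQbullet R Qc Qb unfold to Qc ≈ Fcirc Qb and Qb ≈ Fbullet Qc.
  Fcirc Fbullet : LS (suc p) → LS (suc p)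
  Fcirc   X = shift (- 1ℤ) (embed R) ⊕ (weighted posPart X ⊕ yTerm X)
  Fbullet X = zL ⊕ (weighted negPart X ⊕ yTerm X)

  module _ {d : ℕ} {X X′ : LS (suc p)} (wfX : WF X) (wfX′ : WF X′) (a : AgreeBelow d X X′) where

    AgreeBelow-weighted : {cut : LS (suc p) → LS (suc p)} →
      (∀ {Y Y′} → AgreeBelow d Y Y′ → AgreeBelow d (cut Y) (cut Y′)) →
      AgreeBelow (suc d) (weighted cut X) (weighted cut X′)
    AgreeBelow-weighted cut-agrees = AgreeBelow-∑L (allFin p) λ i →
      AgreeBelow-varₚ-⊗ (Fin.suc i) (cut-agrees (AgreeBelow-powL X X′ wfX wfX′ a (toℕ i)))

    AgreeBelow-yTerm : AgreeBelow (suc d) (yTerm X) (yTerm X′)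
    AgreeBelow-yTerm = AgreeBelow-varₚ-⊗ Fin.zero (AgreeBelow-pred (AgreeBelow-weighted id))

    AgreeBelow-Fcirc : AgreeBelow (suc d) (Fcirc X) (Fcirc X′)
    AgreeBelow-Fcirc = agreeBelow λ u lt j → cong (coef (shift (- 1ℤ) (embed R)) u j +_)
      (cong₂ _+_ (agree (AgreeBelow-weighted AgreeBelow-posPart) u lt j) (agree AgreeBelow-yTerm u lt j))

    AgreeBelow-Fbullet : AgreeBelow (suc d) (Fbullet X) (Fbullet X′)
    AgreeBelow-Fbullet = agreeBelow λ u lt j → cong (coef zL u j +_)
      (cong₂ _+_ (agree (AgreeBelow-weighted AgreeBelow-negPart) u lt j) (agree AgreeBelow-yTerm u lt j))

  solution-unique : {Qc Qb Qc′ Qb′ : LS (suc p)} → WF Qc → WF Qb → WF Qc′ → WF Qb′ →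
    Qc ≈ Fcirc Qb → Qb ≈ Fbullet Qc → Qc′ ≈ Fcirc Qb′ → Qb′ ≈ Fbullet Qc′ →
    (Qc ≈ Qc′) × (Qb ≈ Qb′)
  solution-unique {Qc} {Qb} {Qc′} {Qb′} wfQc wfQb wfQc′ wfQb′ eqc eqb eqc′ eqb′ =
    AgreeBelow-all⇒≈ (λ d → proj₁ (agree-below d)) , AgreeBelow-all⇒≈ (λ d → proj₂ (agree-below d))
    where
    agree-below : ∀ d → AgreeBelow d Qc Qc′ × AgreeBelow d Qb Qb′
    agree-below zero    = AgreeBelow-zero Qc Qc′ , AgreeBelow-zero Qb Qb′
    agree-below (suc d) with agree-below d
    ... | ac , ab =
      agreeBelow (λ u lt j → trans (eqc u j)
        (trans (agree (AgreeBelow-Fcirc wfQb wfQb′ ab) u lt j) (sym (eqc′ u j)))) ,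
      agreeBelow (λ u lt j → trans (eqb u j)
        (trans (agree (AgreeBelow-Fbullet wfQc wfQc′ ac) u lt j) (sym (eqb′ u j))))

  module _ {X : LS (suc p)} (wfX : WF X) where
    open SetoidReasoning (≈-setoid (suc p))

    σ-weighted : (cut cut′ : LS (suc p) → LS (suc p)) →
      (∀ {Y Y′} → Y ≈ Y′ → cut′ Y ≈ cut′ Y′) → (∀ Y → σ (cut Y) ≈ cut′ (σ Y)) →
      σ (weighted cut X) ≈ weighted cut′ (σ X)
    σ-weighted cut cut′ cut′-cong σ-cut = begin
      σ (weighted cut X)                     ≈⟨ σ-∑L (allFin p) (λ i → embed (gW i) ⊗ cut (powL X (toℕ i))) ⟩
      ∑L (allFin p) (λ i → σ (embed (gW i) ⊗ cut (powL X (toℕ i))))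
                                             ≈⟨ ∑L-cong (allFin p) (λ i → σ-term (gW i) (toℕ i)) ⟩
      weighted cut′ (σ X)                    ∎
      where
      σ-term : (g : PS (suc p)) (k : ℕ) → σ (embed g ⊗ cut (powL X k)) ≈ (embed g ⊗ cut′ (powL (σ X) k))
      σ-term g k = begin
        σ (embed g ⊗ cut (powL X k))    ≈⟨ σ-embed-⊗ g (cut (powL X k)) ⟩
        embed g ⊗ σ (cut (powL X k))    ≈⟨ ⊗-congˡ (embed g) {σ (cut (powL X k))} {cut′ (σ (powL X k))}
                                             (σ-cut (powL X k)) ⟩
        embed g ⊗ cut′ (σ (powL X k))   ≈⟨ ⊗-congˡ (embed g) {cut′ (σ (powL X k))} {cut′ (powL (σ X) k)}
                                             (cut′-cong (σ-powL X wfX k)) ⟩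
        embed g ⊗ cut′ (powL (σ X) k)   ∎

    σ-yTerm : σ (yTerm X) ≈ yTerm (σ X)
    σ-yTerm = begin
      σ (embed yW ⊗ weighted id X)    ≈⟨ σ-embed-⊗ yW (weighted id X) ⟩
      embed yW ⊗ σ (weighted id X)    ≈⟨ ⊗-congˡ (embed yW) {σ (weighted id X)} {weighted id (σ X)}
                                           (σ-weighted id id id (λ Y → ≈-refl {X = σ Y})) ⟩
      embed yW ⊗ weighted id (σ X)    ∎

    σ-Fbullet : σ (Fbullet X) ≈ Fcirc (σ X)
    σ-Fbullet M j =
      trans (σ-⊕ zL (weighted negPart X ⊕ yTerm X) M j) (cong₂ _+_ (σ-zL M j)
        (trans (σ-⊕ (weighted negPart X) (yTerm X) M j)
               (cong₂ _+_ (σ-weighted negPart posPart (λ {Y} {Y′} → posPart-cong {X = Y} {Y′}) σ-negPart M j)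
                          (σ-yTerm M j))))

    σ-Fcirc : σ (Fcirc X) ≈ Fbullet (σ X)
    σ-Fcirc M j =
      trans (σ-⊕ (shift (- 1ℤ) (embed R)) (weighted posPart X ⊕ yTerm X) M j) (cong₂ _+_ (σ-z⁻¹R M j)
        (trans (σ-⊕ (weighted posPart X) (yTerm X) M j)
               (cong₂ _+_ (σ-weighted posPart negPart (λ {Y} {Y′} → negPart-cong {X = Y} {Y′}) σ-posPart M j)
                          (σ-yTerm M j))))

  duality : {Qc Qb : LS (suc p)} → WF Qc → WF Qb → EqQcirc R Qc Qb → EqQbullet R Qc Qb →
    (Qc ≈ σ Qb) × (Qb ≈ σ Qc)
  duality {Qc} {Qb} wfQc wfQb eqc eqb =
    solution-unique {Qc} {Qb} {σ Qb} {σ Qc} wfQc wfQb (WF-σ Qb wfQb) (WF-σ Qc wfQc) eqc eqb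
      (λ M j → trans (σ-cong {Qb} {Fbullet Qc} eqb M j) (σ-Fbullet wfQc M j))
      (λ M j → trans (σ-cong {Qc} {Fcirc Qb} eqc M j) (σ-Fcirc wfQb M j))

  const0-z-powL-dual : {Qc Qb : LS (suc p)} → WF Qc → WF Qb → Qb ≈ σ Qc → (k : ℕ) →
    const0 (shift 1ℤ (powL Qb k)) ≈ₚ (const0 (shift (- 1ℤ) (powL Qc k)) *ₚ R)
  const0-z-powL-dual {Qc} {Qb} wfQc wfQb Qb≈σQc k M = begin
    coef (powL Qb k) M (- 1ℤ)                   ≡⟨ powL-cong Qb (σ Qc) wfQb (WF-σ Qc wfQc) Qb≈σQc k M (- 1ℤ) ⟩
    coef (powL (σ Qc) k) M (- 1ℤ)               ≡⟨ σ-powL Qc wfQc k M (- 1ℤ) ⟨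
    (powL Qc k [z^ 1ℤ ] *ₚ (R *ₚ oneₚ)) M       ≡⟨ *ₚ-congˡ (powL Qc k [z^ 1ℤ ]) (*ₚ-identityʳ R) M ⟩
    (powL Qc k [z^ 1ℤ ] *ₚ R) M                 ∎
    where open ≡-Reasoning

  R-formula : {Qc Qb : LS (suc p)} → EqR R Qc Qb →
    (∀ k → const0 (shift 1ℤ (powL Qb k)) ≈ₚ (const0 (shift (- 1ℤ) (powL Qc k)) *ₚ R)) →
    R ≈ₚ (oneₚ +ₚ Σₚ (λ i → gW i *ₚ const0 (shift 1ℤ (powL Qb (toℕ i)))))
  R-formula {Qc} {Qb} eqR dual = begin
    R                                                           ≈⟨ eqR ⟩
    oneₚ +ₚ (∑ₚ (allFin p) (λ i → gW i *ₚ c i) *ₚ R)            ≈⟨ +ₚ-congˡ oneₚ (*ₚ-distribʳ-∑ₚ (allFin p) (λ i → gW i *ₚ c i) R) ⟩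
    oneₚ +ₚ ∑ₚ (allFin p) (λ i → (gW i *ₚ c i) *ₚ R)            ≈⟨ +ₚ-congˡ oneₚ (∑ₚ-cong (allFin p) λ i →
                                                                      ≈ₚ-trans (*ₚ-assoc (gW i) (c i) R)
                                                                               (*ₚ-congˡ (gW i) (≈ₚ-sym (dual (toℕ i))))) ⟩
    oneₚ +ₚ Σₚ (λ i → gW i *ₚ const0 (shift 1ℤ (powL Qb (toℕ i)))) ∎
    where
    open ≈ₚ-Reasoning
    c : Fin p → PS (suc p)
    c i = const0 (shift (- 1ℤ) (powL Qc (toℕ i)))

mainTheorem7 : (p : ℕ) (R Rinv : PS (suc p)) (Qc Qb : LS (suc p)) →
    WF Qc → WF Qb →
    EqQcirc R Qc Qb → EqQbullet R Qc Qb → EqR R Qc Qb →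
    (R *ₚ Rinv) ≈ₚ oneₚ →
    (Qc ≈ substRz Qb R Rinv)
    × (R ≈ₚ (oneₚ +ₚ Σₚ (λ i → gW i *ₚ const0 (shift 1ℤ (powL Qb (toℕ i))))))
mainTheorem7 p R Rinv Qc Qb wfQc wfQb eqc eqb eqR R*Rinv≈1 =
  let open System p R Rinv R*Rinv≈1
      (Qc≈σQb , Qb≈σQc) = duality wfQc wfQb eqc eqb
  in Qc≈σQb , R-formula eqR (const0-z-powL-dual wfQc wfQb Qb≈σQc)
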